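{- There exists a sequence of polynomials $d_n(b_2,\dots,b_n)$, $n\geq 1$ (with $d_1$ a constant), with coefficients in the ring $\mathbb{Z}[1/2]$ of dyadic rationals and of degree at most $1$ in each of the variables, such that for every additive basis $A$ of $\mathbb{N}$ and every $n\geq 1$: $$r_{n+1}=d_n(r_2,\dots,r_n)\ \text{ if } n+1\notin A,\qquad r_{n+1}=d_n(r_2,\dots,r_n)+2\ \text{ if } n+1\in A,$$ where $r_k$ denotes the number of $A$-representations of $k$.
   Context: $\mathbb{N}=\{0,1,2,\dots\}$. For $A\subset\mathbb{N}$ and $n\in\mathbb{N}$, an $A$-representation of $n$ is an ordered pair $(x,y)\in A\times A$ with $x+y=n$, and $r_n$ is the number of such pairs. $A$ is called a basis of $\mathbb{N}$ if $r_n>0$ for every $n\in\mathbb{N}$. -}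

module Defs where

open import Data.Nat using (ℕ; zero; suc; _+_; _∸_; _^_; _<_)
open import Data.Bool using (Bool; true; false; _∧_; if_then_else_)
open import Data.List using (List; map; upTo)
open import Data.Nat.ListAction using (sum)
open import Data.Vec using (Vec; []; _∷_)
open import Data.Product using (_×_; _,_; ∃)
open import Data.Unit using (⊤)
open import Data.Integer using (+_)
open import Data.Rational using (ℚ; ↧ₙ_; _/_)
import Data.Rational as Q
open import Relation.Binary.PropositionalEquality using (_≡_)

Subsetℕ : Set
Subsetℕ = ℕ → Bool

-- r A n = number of ordered pairs (x , y) ∈ A × A with x + y = n,
-- i.e. the number of x ∈ {0,…,n} with x ∈ A and n ∸ x ∈ A.
r : Subsetℕ → ℕ → ℕ
r A n = sum (map (λ x → if A x ∧ A (n ∸ x) then 1 else 0) (upTo (suc n)))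

IsBasis : Subsetℕ → Set
IsBasis A = ∀ n → 0 < r A n

-- Polynomials with rational coefficients in m variables, of degree at most 1
-- in each variable (multilinear), represented recursively:
-- MPoly 0 = constants; an element (p , q) of MPoly (suc m) stands for
-- p + x₀ · q where x₀ is the first variable and p, q involve only the rest.
MPoly : ℕ → Set
MPoly zero    = ℚ
MPoly (suc m) = MPoly m × MPoly m

eval : ∀ {m} → MPoly m → Vec ℚ m → ℚ
eval {zero}  c       []       = c
eval {suc m} (p , q) (x ∷ xs) = eval p xs Q.+ x Q.* eval q xs

IsDyadic : ℚ → Set
IsDyadic q = ∃ λ k → ↧ₙ q ≡ 2 ^ k

DyadicCoeffs : ∀ {m} → MPoly m → Set
DyadicCoeffs {zero}  c       = IsDyadic c
DyadicCoeffs {suc m} (p , q) = DyadicCoeffs p × DyadicCoeffs q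

ℕ→ℚ : ℕ → ℚ
ℕ→ℚ n = + n / 1

{-# OPTIONS --safe #-}
-- For a basis, 0, 1 ∈ A, so the representations 0 + n and n + 0 contribute 2·[n ∈ A] to r n
-- while the others only involve A ∩ [1, n − 1]: writing a j = [j ∈ A],
-- r (k + 2) = c k (a (k + 1), …, a 2) + 2 a (k + 2) for a pair count c k.
-- This system is triangular, a (k + 1) = (r (k + 1) − c (k − 1) (…)) / 2, so by induction on k
-- every dyadic function of a 2, …, a (k + 1), in particular c k, is a polynomial in
-- r 2, …, r (k + 1) that is multilinear with dyadic coefficients: each step substitutes
-- a dyadic affine expression in the one new variable.
module Submission where

open import Defs
open import Function using (_∘_)
open import Data.Bool using (Bool; true; false; _∧_; if_then_else_)
open import Data.Nat as ℕ using (ℕ; zero; suc; _+_; _*_; _∸_; _^_; _≤_; _<_; z≤n; s≤s)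
import Data.Nat.Properties as ℕ
open import Data.Nat.Divisibility using (_∣_; divides; _∣?_; ∣-refl; ∣-trans; *-pres-∣; ∣1⇒≡1; *-cancelʳ-∣)
open import Data.Nat.Coprimality using (Coprime; coprime-divisor; 1-coprimeTo)
import Data.Nat.Coprimality as Coprime
open import Data.Nat.Primality using (Prime; prime[2]; prime⇒irreducible; prime⇒nonZero)
open import Data.Nat.ListAction using (sum)
open import Data.Nat.ListAction.Properties using (sum-++)
open import Data.Integer as ℤ using (ℤ; +_)
import Data.Integer.Properties as ℤ
open import Data.Rational as ℚ using (ℚ; ↧ₙ_; ½; mkℚ)
import Data.Rational.Properties as ℚ
open import Data.Rational.Solver using (module +-*-Solver)
open import Data.List as List using (applyUpTo; _∷ʳ_)
open import Data.List.Properties using (map-upTo; applyUpTo-∷ʳ)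
open import Data.Vec as Vec using (Vec; []; _∷_; tabulate)
open import Data.Fin using (toℕ)
open import Data.Product using (Σ; _×_; _,_; ∃)
open import Data.Sum using (inj₁; inj₂)
open import Relation.Nullary using (yes; no; contradiction)
open import Relation.Binary.PropositionalEquality

open +-*-Solver using (solve; _:=_; _:+_; _:-_; _:*_; con)

∣p^k⇒≡p^j : ∀ {p d} → Prime p → ∀ k → d ∣ p ^ k → ∃ λ j → d ≡ p ^ j
∣p^k⇒≡p^j pr zero d∣1 = 0 , ∣1⇒≡1 d∣1
∣p^k⇒≡p^j {p} {d} pr (suc k) d∣p^[1+k] with p ∣? d
... | yes (divides e refl) =
  let j , e≡p^j = ∣p^k⇒≡p^j pr k e∣p^k in suc j , trans (cong (_* p) e≡p^j) (ℕ.*-comm (p ^ j) p)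
  where
  instance p≢0 = prime⇒nonZero pr
  e∣p^k : e ∣ p ^ k
  e∣p^k = *-cancelʳ-∣ p (subst (e * p ∣_) (ℕ.*-comm p (p ^ k)) d∣p^[1+k])
... | no p∤d = ∣p^k⇒≡p^j pr k (coprime-divisor d⊥p d∣p^[1+k])
  where
  d⊥p : Coprime d p
  d⊥p (c∣d , c∣p) with prime⇒irreducible pr c∣p
  ... | inj₁ c≡1 = c≡1
  ... | inj₂ refl = contradiction c∣d p∤d

-- Equivalent to IsDyadic (by ∣p^k⇒≡p^j), but visibly closed under the ring operations.
record Dyadic (q : ℚ) : Set where
  constructor _,_
  field
    exponent : ℕ
    ↧ₙ∣2^exponent : ↧ₙ q ∣ 2 ^ exponent

Dyadic⇒IsDyadic : ∀ {q} → Dyadic q → IsDyadic q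
Dyadic⇒IsDyadic (k , ↧q∣2^k) = ∣p^k⇒≡p^j prime[2] k ↧q∣2^k

↧ₙ-∣ : ∀ {r p q : ℚ} {g : ℤ} → ℚ.↧ r ℤ.* g ≡ ℚ.↧ p ℤ.* ℚ.↧ q → ↧ₙ r ∣ ↧ₙ p * ↧ₙ q
↧ₙ-∣ {r} {p} {q} {g} eq = divides ℤ.∣ g ∣ (begin
  ↧ₙ p * ↧ₙ q                   ≡⟨ ℤ.abs-* (ℚ.↧ p) (ℚ.↧ q) ⟨
  ℤ.∣ ℚ.↧ p ℤ.* ℚ.↧ q ∣         ≡⟨ cong ℤ.∣_∣ eq ⟨
  ℤ.∣ ℚ.↧ r ℤ.* g ∣             ≡⟨ ℤ.abs-* (ℚ.↧ r) g ⟩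
  ↧ₙ r * ℤ.∣ g ∣                ≡⟨ ℕ.*-comm (↧ₙ r) ℤ.∣ g ∣ ⟩
  ℤ.∣ g ∣ * ↧ₙ r                ∎)
  where open ≡-Reasoning

↧ₙ-+-∣ : ∀ p q → ↧ₙ (p ℚ.+ q) ∣ ↧ₙ p * ↧ₙ q
↧ₙ-+-∣ p q = ↧ₙ-∣ {p ℚ.+ q} {p} {q} (ℚ.↧-+ p q)

↧ₙ-*-∣ : ∀ p q → ↧ₙ (p ℚ.* q) ∣ ↧ₙ p * ↧ₙ q
↧ₙ-*-∣ p q = ↧ₙ-∣ {p ℚ.* q} {p} {q} (ℚ.↧-* p q)

dyadic-+ : ∀ {p q} → Dyadic p → Dyadic q → Dyadic (p ℚ.+ q)
dyadic-+ {p} {q} (a , ↧p∣2^a) (b , ↧q∣2^b) =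
  a + b , subst (_ ∣_) (sym (ℕ.^-distribˡ-+-* 2 a b)) (∣-trans (↧ₙ-+-∣ p q) (*-pres-∣ ↧p∣2^a ↧q∣2^b))

dyadic-* : ∀ {p q} → Dyadic p → Dyadic q → Dyadic (p ℚ.* q)
dyadic-* {p} {q} (a , ↧p∣2^a) (b , ↧q∣2^b) =
  a + b , subst (_ ∣_) (sym (ℕ.^-distribˡ-+-* 2 a b)) (∣-trans (↧ₙ-*-∣ p q) (*-pres-∣ ↧p∣2^a ↧q∣2^b))

dyadic-neg : ∀ {p} → Dyadic p → Dyadic (ℚ.- p)
dyadic-neg {p} (a , ↧p∣2^a) = a , subst (_∣ 2 ^ a) (cong ℤ.∣_∣ (sym (ℚ.↧-neg p))) ↧p∣2^a

dyadic-- : ∀ {p q} → Dyadic p → Dyadic q → Dyadic (p ℚ.- q)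
dyadic-- dp dq = dyadic-+ dp (dyadic-neg dq)

dyadic-½ : Dyadic ½
dyadic-½ = 1 , ∣-refl

ℕ→ℚ≡mkℚ : ∀ n → ℕ→ℚ n ≡ mkℚ (+ n) 0 (Coprime.sym (1-coprimeTo n))
ℕ→ℚ≡mkℚ n = ℚ.normalize-coprime (Coprime.sym (1-coprimeTo n))

dyadic-ℕ : ∀ n → Dyadic (ℕ→ℚ n)
dyadic-ℕ n = 0 , subst (λ q → ↧ₙ q ∣ 1) (sym (ℕ→ℚ≡mkℚ n)) ∣-refl

ℕ→ℚ-+ : ∀ m n → ℕ→ℚ (m + n) ≡ ℕ→ℚ m ℚ.+ ℕ→ℚ n
ℕ→ℚ-+ m n rewrite ℕ→ℚ≡mkℚ m | ℕ→ℚ≡mkℚ n | ℕ.*-identityʳ m | ℕ.*-identityʳ n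
  | ℤ.+◃n≡+n m | ℤ.+◃n≡+n n = cong (ℚ._/ 1) (ℤ.pos-+ m n)

bool→ℕ : Bool → ℕ
bool→ℕ b = if b then 1 else 0

applyUpTo-cong : ∀ {a} {X : Set a} {f g : ℕ → X} n → (∀ x → x < n → f x ≡ g x) →
                 applyUpTo f n ≡ applyUpTo g n
applyUpTo-cong zero    f≡g = refl
applyUpTo-cong (suc n) f≡g =
  cong₂ List._∷_ (f≡g 0 (s≤s z≤n)) (applyUpTo-cong n (λ x x<n → f≡g (suc x) (s≤s x<n)))

innerPairs : Subsetℕ → ℕ → ℕ
innerPairs A m = sum (applyUpTo (λ x → bool→ℕ (A (suc x) ∧ A (m ∸ x))) m)

innerPairs-cong : ∀ {A B} m → (∀ x → x ≤ m → A x ≡ B x) → innerPairs A m ≡ innerPairs B m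
innerPairs-cong m A≡B = cong sum (applyUpTo-cong m (λ x x<m →
  cong₂ (λ a b → bool→ℕ (a ∧ b)) (A≡B (suc x) x<m) (A≡B (m ∸ x) (ℕ.m∸n≤m m x))))

-- The representations 0 + (m + 1) and (m + 1) + 0 give the term 2 * bool→ℕ (A (suc m)).
r-suc : ∀ {A} → A 0 ≡ true → ∀ m → r A (suc m) ≡ innerPairs A m + 2 * bool→ℕ (A (suc m))
r-suc {A} 0∈A m = begin
  r A (suc m)
    ≡⟨ cong sum (map-upTo f (2 + m)) ⟩
  f 0 + sum (applyUpTo (f ∘ suc) (suc m))
    ≡⟨ cong (λ xs → f 0 + sum xs) (applyUpTo-∷ʳ (f ∘ suc) m) ⟨
  f 0 + sum (applyUpTo (f ∘ suc) m ∷ʳ f (suc m))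
    ≡⟨ cong (_+_ (f 0)) (sum-++ (applyUpTo (f ∘ suc) m) List.[ f (suc m) ]) ⟩
  f 0 + (innerPairs A m + (f (suc m) + 0))
    ≡⟨ cong₂ (λ a b → bool→ℕ (a ∧ A (suc m)) + (innerPairs A m + (bool→ℕ (A (suc m) ∧ b) + 0)))
             0∈A (trans (cong A (ℕ.n∸n≡0 m)) 0∈A) ⟩
  bool→ℕ (A (suc m)) + (innerPairs A m + (bool→ℕ (A (suc m) ∧ true) + 0))
    ≡⟨ outer (A (suc m)) ⟩
  innerPairs A m + 2 * bool→ℕ (A (suc m)) ∎
  where
  open ≡-Reasoning
  f : ℕ → ℕ
  f x = bool→ℕ (A x ∧ A (suc m ∸ x))
  outer : ∀ b → bool→ℕ b + (innerPairs A m + (bool→ℕ (b ∧ true) + 0)) ≡ innerPairs A m + 2 * bool→ℕ b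
  outer false = refl
  outer true  = sym (ℕ.+-suc (innerPairs A m) 1)

applyDownFromᵛ : ∀ {a} {X : Set a} → (ℕ → X) → (k : ℕ) → Vec X k
applyDownFromᵛ f zero    = []
applyDownFromᵛ f (suc k) = f k ∷ applyDownFromᵛ f k

-- bitsOf A k = (A (k + 1), …, A 3, A 2)
bitsOf : Subsetℕ → (k : ℕ) → Vec Bool k
bitsOf A = applyDownFromᵛ (λ j → A (2 + j))

fromBits : ∀ {k} → Vec Bool k → Subsetℕ
fromBits []               x = x ℕ.≤ᵇ 1
fromBits {suc k} (b ∷ bs) x with x ℕ.≟ 2 + k
... | yes _ = b
... | no  _ = fromBits bs x

fromBits-bitsOf : ∀ {A} → A 0 ≡ true → A 1 ≡ true → ∀ k x → x ≤ suc k → fromBits (bitsOf A k) x ≡ A x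
fromBits-bitsOf 0∈A 1∈A zero 0 _ = sym 0∈A
fromBits-bitsOf 0∈A 1∈A zero 1 _ = sym 1∈A
fromBits-bitsOf 0∈A 1∈A zero (suc (suc x)) (s≤s ())
fromBits-bitsOf {A} 0∈A 1∈A (suc k) x x≤2+k with x ℕ.≟ 2 + k
... | yes refl = refl
... | no  x≢2+k = fromBits-bitsOf {A} 0∈A 1∈A k x (ℕ.≤-pred (ℕ.≤∧≢⇒< x≤2+k x≢2+k))

pairCount : ∀ {k} → Vec Bool k → ℕ
pairCount {k} bs = innerPairs (fromBits bs) (suc k)

r-bitsOf : ∀ {A} → A 0 ≡ true → A 1 ≡ true → ∀ k →
           r A (2 + k) ≡ pairCount (bitsOf A k) + 2 * bool→ℕ (A (2 + k))
r-bitsOf {A} 0∈A 1∈A k = trans (r-suc {A} 0∈A (suc k)) (cong (_+ 2 * bool→ℕ (A (2 + k))) inner≡)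
  where
  inner≡ : innerPairs A (suc k) ≡ pairCount (bitsOf A k)
  inner≡ = innerPairs-cong (suc k) (λ x x≤1+k → sym (fromBits-bitsOf {A} 0∈A 1∈A k x x≤1+k))

basis⇒0∈ : ∀ {A} → IsBasis A → A 0 ≡ true
basis⇒0∈ {A} basis with A 0 | basis 0
... | true | _ = refl

basis⇒1∈ : ∀ {A} → IsBasis A → A 1 ≡ true
basis⇒1∈ {A} basis with A 0 | A 1 | basis 1
... | _     | true | _ = refl
... | false | false | ()

tabulate-∷ʳ : ∀ {a} {X : Set a} (f : ℕ → X) n →
              tabulate (f ∘ toℕ) Vec.∷ʳ f n ≡ tabulate {n = suc n} (f ∘ toℕ)
tabulate-∷ʳ f zero    = refl
tabulate-∷ʳ f (suc n) = cong (f 0 ∷_) (tabulate-∷ʳ (f ∘ suc) n)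

addLast : ∀ {m} → MPoly m → MPoly m → MPoly (suc m)
addLast {zero}  p        q        = p , q
addLast {suc m} (p₀ , p₁) (q₀ , q₁) = addLast p₀ q₀ , addLast p₁ q₁

eval-addLast : ∀ {m} (p q : MPoly m) xs x → eval (addLast p q) (xs Vec.∷ʳ x) ≡ eval p xs ℚ.+ x ℚ.* eval q xs
eval-addLast {zero}  p         q         []       x = refl
eval-addLast {suc m} (p₀ , p₁) (q₀ , q₁) (y ∷ ys) x = begin
  eval (addLast p₀ q₀) (ys Vec.∷ʳ x) ℚ.+ y ℚ.* eval (addLast p₁ q₁) (ys Vec.∷ʳ x)
    ≡⟨ cong₂ (λ a b → a ℚ.+ y ℚ.* b) (eval-addLast p₀ q₀ ys x) (eval-addLast p₁ q₁ ys x) ⟩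
  (eval p₀ ys ℚ.+ x ℚ.* eval q₀ ys) ℚ.+ y ℚ.* (eval p₁ ys ℚ.+ x ℚ.* eval q₁ ys)
    ≡⟨ regroup (eval p₀ ys) (eval q₀ ys) (eval p₁ ys) (eval q₁ ys) x y ⟩
  (eval p₀ ys ℚ.+ y ℚ.* eval p₁ ys) ℚ.+ x ℚ.* (eval q₀ ys ℚ.+ y ℚ.* eval q₁ ys) ∎
  where
  open ≡-Reasoning
  regroup : ∀ a b c d x y → (a ℚ.+ x ℚ.* b) ℚ.+ y ℚ.* (c ℚ.+ x ℚ.* d) ≡ (a ℚ.+ y ℚ.* c) ℚ.+ x ℚ.* (b ℚ.+ y ℚ.* d)
  regroup = solve 6 (λ a b c d x y → (a :+ x :* b) :+ y :* (c :+ x :* d) := (a :+ y :* c) :+ x :* (b :+ y :* d)) refl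

dyadic-addLast : ∀ {m} {p q : MPoly m} → DyadicCoeffs p → DyadicCoeffs q → DyadicCoeffs (addLast p q)
dyadic-addLast {zero}  dp         dq         = dp , dq
dyadic-addLast {suc m} (dp₀ , dp₁) (dq₀ , dq₁) = dyadic-addLast dp₀ dq₀ , dyadic-addLast dp₁ dq₁

-- The bit is recovered from v = c + 2 b as b = (v − c) / 2, and h b = h false + b (h true − h false).
interpolate-bit : ∀ (h : Bool → ℚ) c b →
  (h false ℚ.- ½ ℚ.* c ℚ.* (h true ℚ.- h false)) ℚ.+ (c ℚ.+ ℕ→ℚ (2 * bool→ℕ b)) ℚ.* (½ ℚ.* (h true ℚ.- h false))
    ≡ h b
interpolate-bit h c false = solve 3 (λ g₀ g₁ c →
  (g₀ :- con ½ :* c :* (g₁ :- g₀)) :+ (c :+ con (ℕ→ℚ 0)) :* (con ½ :* (g₁ :- g₀)) := g₀) refl (h false) (h true) c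
interpolate-bit h c true  = solve 3 (λ g₀ g₁ c →
  (g₀ :- con ½ :* c :* (g₁ :- g₀)) :+ (c :+ con (ℕ→ℚ 2)) :* (con ½ :* (g₁ :- g₀)) := g₁) refl (h false) (h true) c

module Interpolation
  {X : Set} (bit : X → ℕ → Bool) (value : X → ℕ → ℚ)
  (c : ∀ {k} → Vec Bool k → ℚ) (dyadic-c : ∀ {k} (bs : Vec Bool k) → Dyadic (c bs))
  (value≡ : ∀ x k → value x k ≡ c (applyDownFromᵛ (bit x) k) ℚ.+ ℕ→ℚ (2 * bool→ℕ (bit x k)))
  where

  values : X → (k : ℕ) → Vec ℚ k
  values x k = tabulate (value x ∘ toℕ)

  bits : X → (k : ℕ) → Vec Bool k
  bits x = applyDownFromᵛ (bit x)

  record Interpolant {k} (g : Vec Bool k → ℚ) : Set where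
    field
      poly        : MPoly k
      poly-dyadic : DyadicCoeffs poly
      eval-poly   : ∀ x → eval poly (values x k) ≡ g (bits x k)

  interpolate : ∀ {k} (g : Vec Bool k → ℚ) → (∀ bs → Dyadic (g bs)) → Interpolant g
  interpolate {zero}  g dyadic-g = record
    { poly = g [] ; poly-dyadic = Dyadic⇒IsDyadic (dyadic-g []) ; eval-poly = λ _ → refl }
  interpolate {suc k} g dyadic-g = record
    { poly = addLast P.poly Q.poly ; poly-dyadic = dyadic-addLast P.poly-dyadic Q.poly-dyadic ; eval-poly = eval≡ }
    where
    jump : Vec Bool k → ℚ
    jump bs = g (true ∷ bs) ℚ.- g (false ∷ bs)

    dyadic-jump : ∀ bs → Dyadic (jump bs)
    dyadic-jump bs = dyadic-- (dyadic-g (true ∷ bs)) (dyadic-g (false ∷ bs))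

    module P = Interpolant (interpolate (λ bs → g (false ∷ bs) ℚ.- ½ ℚ.* c bs ℚ.* jump bs)
      (λ bs → dyadic-- (dyadic-g (false ∷ bs)) (dyadic-* (dyadic-* dyadic-½ (dyadic-c bs)) (dyadic-jump bs))))
    module Q = Interpolant (interpolate (λ bs → ½ ℚ.* jump bs) (λ bs → dyadic-* dyadic-½ (dyadic-jump bs)))

    eval≡ : ∀ x → eval (addLast P.poly Q.poly) (values x (suc k)) ≡ g (bits x (suc k))
    eval≡ x = begin
      eval (addLast P.poly Q.poly) (values x (suc k))
        ≡⟨ cong (eval (addLast P.poly Q.poly)) (tabulate-∷ʳ (value x) k) ⟨
      eval (addLast P.poly Q.poly) (values x k Vec.∷ʳ value x k)
        ≡⟨ eval-addLast P.poly Q.poly (values x k) (value x k) ⟩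
      eval P.poly (values x k) ℚ.+ value x k ℚ.* eval Q.poly (values x k)
        ≡⟨ cong₂ ℚ._+_ (P.eval-poly x) (cong₂ ℚ._*_ (value≡ x k) (Q.eval-poly x)) ⟩
      (g (false ∷ bs) ℚ.- ½ ℚ.* c bs ℚ.* jump bs) ℚ.+ (c bs ℚ.+ ℕ→ℚ (2 * bool→ℕ (bit x k))) ℚ.* (½ ℚ.* jump bs)
        ≡⟨ interpolate-bit (λ b → g (b ∷ bs)) (c bs) (bit x k) ⟩
      g (bit x k ∷ bs) ∎
      where
      open ≡-Reasoning
      bs = bits x k

Basis : Set
Basis = Σ Subsetℕ IsBasis

r-recurrence : ∀ ((A , basis) : Basis) k →
  ℕ→ℚ (r A (k + 2)) ≡ ℕ→ℚ (pairCount (bitsOf A k)) ℚ.+ ℕ→ℚ (2 * bool→ℕ (A (2 + k)))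
r-recurrence (A , basis) k = begin
  ℕ→ℚ (r A (k + 2))                                      ≡⟨ cong (ℕ→ℚ ∘ r A) (ℕ.+-comm k 2) ⟩
  ℕ→ℚ (r A (2 + k))                                      ≡⟨ cong ℕ→ℚ (r-bitsOf {A} (basis⇒0∈ {A} basis) (basis⇒1∈ {A} basis) k) ⟩
  ℕ→ℚ (pairCount (bitsOf A k) + 2 * bool→ℕ (A (2 + k)))  ≡⟨ ℕ→ℚ-+ (pairCount (bitsOf A k)) _ ⟩
  ℕ→ℚ (pairCount (bitsOf A k)) ℚ.+ ℕ→ℚ (2 * bool→ℕ (A (2 + k))) ∎
  where open ≡-Reasoning

open Interpolation {Basis} (λ (A , _) j → A (2 + j)) (λ (A , _) j → ℕ→ℚ (r A (j + 2)))
  (λ bs → ℕ→ℚ (pairCount bs)) (λ bs → dyadic-ℕ (pairCount bs)) r-recurrence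
  using (Interpolant; interpolate; values)
open Interpolant

pairCount-interpolant : ∀ m → Interpolant {m} (λ bs → ℕ→ℚ (pairCount bs))
pairCount-interpolant m = interpolate _ (λ bs → dyadic-ℕ (pairCount bs))

r-by-interpolant : ∀ ((A , basis) : Basis) m {b} → A (m + 2) ≡ b →
  ℕ→ℚ (r A (m + 2)) ≡ eval (poly (pairCount-interpolant m)) (values (A , basis) m) ℚ.+ ℕ→ℚ (2 * bool→ℕ b)
r-by-interpolant (A , basis) m refl = begin
  ℕ→ℚ (r A (m + 2))
    ≡⟨ r-recurrence (A , basis) m ⟩
  ℕ→ℚ (pairCount (bitsOf A m)) ℚ.+ ℕ→ℚ (2 * bool→ℕ (A (2 + m)))
    ≡⟨ cong₂ (λ a b → a ℚ.+ ℕ→ℚ (2 * bool→ℕ b))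
             (sym (eval-poly (pairCount-interpolant m) (A , basis))) (cong A (ℕ.+-comm 2 m)) ⟩
  eval (poly (pairCount-interpolant m)) (values (A , basis) m) ℚ.+ ℕ→ℚ (2 * bool→ℕ (A (m + 2))) ∎
  where open ≡-Reasoning

mainTheorem1 :
  Σ ((m : ℕ) → MPoly m) λ d →
    ((m : ℕ) → DyadicCoeffs (d m)) ×
    ((A : Subsetℕ) → IsBasis A → (m : ℕ) →
      ((A (m + 2) ≡ false →
          ℕ→ℚ (r A (m + 2)) ≡ eval (d m) (tabulate (λ i → ℕ→ℚ (r A (toℕ i + 2))))) ×
       (A (m + 2) ≡ true →
          ℕ→ℚ (r A (m + 2)) ≡ eval (d m) (tabulate (λ i → ℕ→ℚ (r A (toℕ i + 2)))) ℚ.+ ℕ→ℚ 2)))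
mainTheorem1 =
  (λ m → poly (pairCount-interpolant m)) ,
  (λ m → poly-dyadic (pairCount-interpolant m)) ,
  λ A basis m →
    (λ m+2∉A → trans (r-by-interpolant (A , basis) m m+2∉A) (ℚ.+-identityʳ _)) ,
    (λ m+2∈A → r-by-interpolant (A , basis) m m+2∈A)
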